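{- Let $q\ge 5$ and $d\ge 0$ be integers, and let $T$ be the complete $q$-ary tree of depth $d$. Then $\Phi_V(T)\ge d$.
   Context: The complete $q$-ary tree of depth $d$ is the rooted tree in which every vertex at distance less than $d$ from the root has exactly $q$ children, and the vertices at distance $d$ from the root are leaves. For a graph $G$ and $S\subseteq V(G)$, $\delta(S)=\{v\in V(G)\setminus S : N(v)\cap S\neq\emptyset\}$; $\Phi_V(G,s)=\min_{|S|=s}|\delta(S)|$ and $\Phi_V(G)=\max_{0\le s\le |V(G)|}\Phi_V(G,s)$. -}

module Defs where

open import Data.Nat using (ℕ; zero; suc; _+_; _*_; _≤_)
open import Data.Fin using (Fin; toℕ)
open import Data.Fin.Subset using (Subset; _∈_; _∉_; ∣_∣)
open import Data.Product using (Σ; ∃; _×_)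
open import Data.Sum using (_⊎_)
open import Relation.Binary.PropositionalEquality using (_≡_)

record Graph (n : ℕ) : Set₁ where
  field
    Adj : Fin n → Fin n → Set

open Graph public

treeSize : ℕ → ℕ → ℕ
treeSize q zero    = 1
treeSize q (suc d) = suc (q * treeSize q d)

-- The complete q-ary tree of depth d, with vertices labelled in breadth-first
-- (heap) order: the root is 0 and the children of vertex i are
-- q*i+1, ..., q*i+q.  The vertices 0 .. treeSize q d - 1 are exactly those at
-- depth ≤ d.
ChildOf : (q : ℕ) {n : ℕ} → Fin n → Fin n → Set
ChildOf q i j = Σ (Fin q) λ a → toℕ j ≡ q * toℕ i + suc (toℕ a)

completeTree : (q d : ℕ) → Graph (treeSize q d)
completeTree q d = record { Adj = λ i j → ChildOf q i j ⊎ ChildOf q j i }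

IsVertexBoundary : {n : ℕ} → Graph n → Subset n → Subset n → Set
IsVertexBoundary G S B =
  ∀ v → (v ∈ B → (v ∉ S × ∃ λ u → u ∈ S × Adj G v u))
      × ((v ∉ S × ∃ λ u → u ∈ S × Adj G v u) → v ∈ B)

-- k ≤ Φ_V(G, s) = min_{|S| = s} |δ(S)|.
PhiVAtLeastAt : {n : ℕ} → Graph n → ℕ → ℕ → Set
PhiVAtLeastAt {n} G s k =
  (S B : Subset n) → ∣ S ∣ ≡ s → IsVertexBoundary G S B → k ≤ ∣ B ∣

-- k ≤ Φ_V(G) = max_{0 ≤ s ≤ |V(G)|} Φ_V(G, s).
PhiVAtLeast : {n : ℕ} → Graph n → ℕ → Set
PhiVAtLeast {n} G k = Σ ℕ λ s → s ≤ n × PhiVAtLeastAt G s k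

module Submission where

-- Take s = ∑_{i ≤ d} c_i with c_i = 2 (1 + q + ⋯ + q^{i-1}), so c_{i+1} = q c_i + 2 and s ≤ |T| as q ≥ 3.
-- Let |S| = s, B = δ(S), and let a_i, b_i count the vertices of S and of B on level i. The parent and the
-- q children of a vertex of S lie in S ∪ B, so a_{i+1} ≤ q (a_i + b_i) and q a_i ≤ a_{i+1} + b_{i+1}; for
-- v_i = a_i - c_i this reads v_{i+1} + 2 ≤ q (v_i + b_i) and q v_i ≤ v_{i+1} + b_{i+1} + 2, with ∑ v_i = 0.
-- When q ≥ 5 every level i < d satisfies 3 v_{i-1}⁺ - v_{i+1}⁻ ≤ 2 (v_i + b_i) - 2. Adding these up, the
-- positive and negative parts of the v_i are absorbed by ∑ v_i = 0, which leaves 2 d ≤ 2 ∑ b_i.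

open import Defs

module Sums where

  open import Data.Nat using (ℕ; zero; suc; _+_; _*_; _≤_; _<_; z≤n; s≤s)
  open import Data.Nat.Properties
  open import Algebra.Properties.CommutativeSemigroup +-commutativeSemigroup using (interchange)
  open import Relation.Binary.PropositionalEquality

  ∑ : ℕ → (ℕ → ℕ) → ℕ
  ∑ zero    f = 0
  ∑ (suc n) f = f 0 + ∑ n (λ k → f (suc k))

  infixl 10 ∑
  syntax ∑ n (λ k → e) = ∑[ k < n ] e

  ∑-cong : ∀ n {f g : ℕ → ℕ} → (∀ k → f k ≡ g k) → ∑ n f ≡ ∑ n g
  ∑-cong zero    f≗g = refl
  ∑-cong (suc n) f≗g = cong₂ _+_ (f≗g 0) (∑-cong n (λ k → f≗g (suc k)))

  ∑-mono-≤ : ∀ n {f g : ℕ → ℕ} → (∀ k → k < n → f k ≤ g k) → ∑ n f ≤ ∑ n g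
  ∑-mono-≤ zero    f≤g = z≤n
  ∑-mono-≤ (suc n) f≤g = +-mono-≤ (f≤g 0 (s≤s z≤n)) (∑-mono-≤ n (λ k k<n → f≤g (suc k) (s≤s k<n)))

  ∑-distrib-+ : ∀ n (f g : ℕ → ℕ) → ∑[ k < n ] (f k + g k) ≡ ∑ n f + ∑ n g
  ∑-distrib-+ zero    f g = refl
  ∑-distrib-+ (suc n) f g = begin
    (f 0 + g 0) + ∑[ k < n ] (f (suc k) + g (suc k))             ≡⟨ cong (f 0 + g 0 +_) (∑-distrib-+ n _ _) ⟩
    (f 0 + g 0) + (∑[ k < n ] f (suc k) + ∑[ k < n ] g (suc k))  ≡⟨ interchange (f 0) (g 0) _ _ ⟩
    (f 0 + ∑[ k < n ] f (suc k)) + (g 0 + ∑[ k < n ] g (suc k))  ∎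
    where open ≡-Reasoning

  ∑-distribˡ-* : ∀ n c (f : ℕ → ℕ) → ∑[ k < n ] (c * f k) ≡ c * ∑ n f
  ∑-distribˡ-* zero    c f = sym (*-zeroʳ c)
  ∑-distribˡ-* (suc n) c f = trans (cong (c * f 0 +_) (∑-distribˡ-* n c _)) (sym (*-distribˡ-+ c (f 0) _))

  ∑-const : ∀ n x → ∑[ k < n ] x ≡ n * x
  ∑-const zero    x = refl
  ∑-const (suc n) x = cong (x +_) (∑-const n x)

  ∑-+ : ∀ m n (f : ℕ → ℕ) → ∑ (m + n) f ≡ ∑ m f + ∑[ k < n ] f (m + k)
  ∑-+ zero    n f = refl
  ∑-+ (suc m) n f = trans (cong (f 0 +_) (∑-+ m n _)) (sym (+-assoc (f 0) _ _))

  ∑-suc : ∀ n (f : ℕ → ℕ) → ∑ (suc n) f ≡ ∑ n f + f n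
  ∑-suc zero    f = +-identityʳ (f 0)
  ∑-suc (suc n) f = trans (cong (f 0 +_) (∑-suc n (λ k → f (suc k)))) (sym (+-assoc (f 0) _ _))

  ∑-blocks : ∀ q n (f : ℕ → ℕ) → ∑ (q * n) f ≡ ∑[ j < n ] ∑[ a < q ] f (q * j + a)
  ∑-blocks q zero    f = cong (λ m → ∑ m f) (*-zeroʳ q)
  ∑-blocks q (suc n) f = begin
    ∑ (q * suc n) f                                                  ≡⟨ cong (λ m → ∑ m f) (*-suc q n) ⟩
    ∑ (q + q * n) f                                                  ≡⟨ ∑-+ q (q * n) f ⟩
    ∑ q f + ∑[ k < q * n ] f (q + k)                                 ≡⟨ cong₂ _+_ first rest ⟩
    ∑[ a < q ] f (q * 0 + a) + ∑[ j < n ] ∑[ a < q ] f (q * suc j + a) ∎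
    where
    open ≡-Reasoning
    first : ∑ q f ≡ ∑[ a < q ] f (q * 0 + a)
    first = ∑-cong q (λ a → cong (λ m → f (m + a)) (sym (*-zeroʳ q)))
    shift : ∀ j a → q + (q * j + a) ≡ q * suc j + a
    shift j a = trans (sym (+-assoc q (q * j) a)) (cong (_+ a) (sym (*-suc q j)))
    rest : ∑[ k < q * n ] f (q + k) ≡ ∑[ j < n ] ∑[ a < q ] f (q * suc j + a)
    rest = trans (∑-blocks q n _) (∑-cong n (λ j → ∑-cong q (λ a → cong f (shift j a))))

module LevelProfile where

  open import Data.Nat as ℕ using (ℕ; zero; suc; z≤n; s≤s)
  open import Data.Integer using (ℤ; +_; -[1+_]; 0ℤ; _+_; _-_; _*_; -_; _≤_; _<_; +≤+; +<+)
  import Data.Integer.Properties as ℤ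
  open import Data.Integer.Tactic.RingSolver using (solve-∀)
  open Sums using (∑)
  open import Data.Sum using (_⊎_; inj₁; inj₂)
  open import Relation.Binary.PropositionalEquality

  infix 9 _⁺ _⁻

  _⁺ : ℤ → ℤ
  (+ n)    ⁺ = + n
  -[1+ n ] ⁺ = 0ℤ

  _⁻ : ℤ → ℤ
  (+ n)    ⁻ = 0ℤ
  -[1+ n ] ⁻ = + suc n

  ∑ℤ : ℕ → (ℕ → ℤ) → ℤ
  ∑ℤ zero    f = 0ℤ
  ∑ℤ (suc n) f = f 0 + ∑ℤ n (λ k → f (suc k))

  -- A linear inequality i ≤ j is proved by writing j - i, with the ring solver, as a sum of products of
  -- quantities already known to be nonnegative.

  0≤+ : ∀ n → 0ℤ ≤ + n
  0≤+ n = +≤+ z≤n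

  infixl 6 _⊕_
  infixl 7 _⊛_

  _⊕_ : ∀ {i j} → 0ℤ ≤ i → 0ℤ ≤ j → 0ℤ ≤ i + j
  0≤i ⊕ 0≤j = ℤ.+-mono-≤ 0≤i 0≤j

  _⊛_ : ∀ {i j} → 0ℤ ≤ i → 0ℤ ≤ j → 0ℤ ≤ i * j
  _⊛_ {+ m} {+ n} _ _ = subst (0ℤ ≤_) (ℤ.pos-* m n) (0≤+ (m ℕ.* n))

  slack : ∀ {i j} → i ≤ j → 0ℤ ≤ j - i
  slack = ℤ.i≤j⇒0≤j-i

  ≤-by-slack : ∀ {i j} s → 0ℤ ≤ s → j - i ≡ s → i ≤ j
  ≤-by-slack s 0≤s j-i≡s = ℤ.0≤i-j⇒j≤i (subst (0ℤ ≤_) (sym j-i≡s) 0≤s)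

  0≤⁻ : ∀ x → 0ℤ ≤ x ⁻
  0≤⁻ (+ n)    = 0≤+ 0
  0≤⁻ -[1+ n ] = 0≤+ (suc n)

  0≤i+i⁻ : ∀ x → 0ℤ ≤ x + x ⁻
  0≤i+i⁻ (+ n)    = subst (0ℤ ≤_) (sym (ℤ.+-identityʳ (+ n))) (0≤+ n)
  0≤i+i⁻ -[1+ n ] = subst (0ℤ ≤_) (sym (ℤ.+-inverseˡ (+ suc n))) (0≤+ 0)

  i+i⁻≤3i⁺ : ∀ x → x + x ⁻ ≤ + 3 * x ⁺
  i+i⁻≤3i⁺ x@(+ n)      = ≤-by-slack _ (0≤+ 2 ⊛ 0≤+ n) (identity x)
    where
    identity : ∀ X → + 3 * X - (X + 0ℤ) ≡ + 2 * X
    identity = solve-∀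
  i+i⁻≤3i⁺ x@(-[1+ n ]) = ≤-by-slack _ (0≤+ 0) (identity x)
    where
    identity : ∀ X → + 3 * 0ℤ - (X + - X) ≡ 0ℤ
    identity = solve-∀

  3i+i⁻≤3i⁺ : ∀ x → + 3 * x + x ⁻ ≤ + 3 * x ⁺
  3i+i⁻≤3i⁺ x@(+ n)      = ≤-by-slack _ (0≤+ 0) (identity x)
    where
    identity : ∀ X → + 3 * X - (+ 3 * X + 0ℤ) ≡ 0ℤ
    identity = solve-∀
  3i+i⁻≤3i⁺ x@(-[1+ n ]) = ≤-by-slack _ (0≤+ 2 ⊛ 0≤+ (suc n)) (identity x)
    where
    identity : ∀ X → + 3 * 0ℤ - (+ 3 * X + - X) ≡ + 2 * - X
    identity = solve-∀

  ∑ℤ-+-+ : ∀ n (f g : ℕ → ℕ) → ∑ℤ n (λ k → + f k - + g k) ≡ + ∑ n f - + ∑ n g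
  ∑ℤ-+-+ zero    f g = refl
  ∑ℤ-+-+ (suc n) f g = begin
    (+ f 0 - + g 0) + ∑ℤ n (λ k → + f (suc k) - + g (suc k))  ≡⟨ cong (λ x → (+ f 0 - + g 0) + x) (∑ℤ-+-+ n _ _) ⟩
    (+ f 0 - + g 0) + (+ ∑ n f′ - + ∑ n g′)                   ≡⟨ regroup (+ f 0) (+ g 0) (+ ∑ n f′) (+ ∑ n g′) ⟩
    (+ f 0 + + ∑ n f′) - (+ g 0 + + ∑ n g′)                   ≡⟨ cong₂ _-_ (ℤ.pos-+ (f 0) _) (ℤ.pos-+ (g 0) _) ⟨
    + ∑ (suc n) f - + ∑ (suc n) g                             ∎
    where
    open ≡-Reasoning
    f′ g′ : ℕ → ℕ
    f′ k = f (suc k)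
    g′ k = g (suc k)
    regroup : ∀ a b c d → (a - b) + (c - d) ≡ (a + c) - (b + d)
    regroup = solve-∀

  ∑ℤ-+ : ∀ n (f : ℕ → ℕ) → ∑ℤ n (λ k → + f k) ≡ + ∑ n f
  ∑ℤ-+ zero    f = refl
  ∑ℤ-+ (suc n) f = trans (cong (λ x → + f 0 + x) (∑ℤ-+ n (λ k → f (suc k)))) (sym (ℤ.pos-+ (f 0) _))

  module _ {q : ℕ} (5≤q : 5 ℕ.≤ q) where

    private
      Q : ℤ
      Q = + q

      0≤Q-5 : 0ℤ ≤ Q - + 5
      0≤Q-5 = slack (+≤+ 5≤q)

      0≤Q-2 : 0ℤ ≤ Q - + 2
      0≤Q-2 = slack (ℤ.≤-trans (+≤+ (s≤s (s≤s z≤n))) (+≤+ 5≤q))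

    level-bound₀-nonpos : ∀ z w → 0ℤ ≤ - z → w + + 2 ≤ Q * z → 0ℤ - w ⁻ ≤ + 2 * z - + 2
    level-bound₀-nonpos z w 0≤-z w≤ =
      ≤-by-slack _ (slack w≤ ⊕ 0≤i+i⁻ w ⊕ 0≤Q-2 ⊛ 0≤-z) (identity Q z w (w ⁻))
      where
      identity : ∀ Q Z w W → (+ 2 * Z - + 2) - (0ℤ - W) ≡ (Q * Z - (w + + 2)) + (w + W) + (Q - + 2) * - Z
      identity = solve-∀

    level-bound₀ : ∀ z w → w + + 2 ≤ Q * z → 0ℤ - w ⁻ ≤ + 2 * z - + 2
    level-bound₀ z@(+ suc m) w _  =
      ≤-by-slack _ (0≤+ 2 ⊛ slack {+ 1} {z} (+≤+ (s≤s z≤n)) ⊕ 0≤⁻ w) (identity z (w ⁻))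
      where
      identity : ∀ Z W → (+ 2 * Z - + 2) - (0ℤ - W) ≡ + 2 * (Z - + 1) + W
      identity = solve-∀
    level-bound₀ z@(+ zero)  w w≤ = level-bound₀-nonpos z w (0≤+ 0) w≤
    level-bound₀ z@(-[1+ m ]) w w≤ = level-bound₀-nonpos z w (0≤+ (suc m)) w≤

    level-bound : ∀ p z w → (0ℤ < p → Q * p ≤ z + + 2) → w + + 2 ≤ Q * z →
                  + 3 * p ⁺ - w ⁻ ≤ + 2 * z - + 2
    level-bound p@(+ suc n) z w link _ =
      ≤-by-slack _ (0≤+ 2 ⊛ slack (link (+<+ (s≤s z≤n))) ⊕ 0≤+ 2 ⊛ 0≤Q-5 ⊛ 0≤+ (suc n)
                     ⊕ 0≤+ 7 ⊛ slack {+ 1} {p} (+≤+ (s≤s z≤n)) ⊕ 0≤+ 1 ⊕ 0≤⁻ w)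
                   (identity Q p z (w ⁻))
      where
      identity : ∀ Q P Z W → (+ 2 * Z - + 2) - (+ 3 * P - W)
                             ≡ + 2 * ((Z + + 2) - Q * P) + + 2 * (Q - + 5) * P + + 7 * (P - + 1) + + 1 + W
      identity = solve-∀
    level-bound (+ zero) z w _ w≤ = level-bound₀ z w w≤
    level-bound -[1+ n ] z w _ w≤ = level-bound₀ z w w≤

    last-level-bound₀ : ∀ v b → 0ℤ ≤ b → + 3 * 0ℤ + v ⁻ ≤ + 2 * b + v ⊎ + 3 * 0ℤ + v ⁻ ≤ + 2 * b - v
    last-level-bound₀ v@(+ m)     b 0≤b = inj₁ (≤-by-slack _ (0≤+ 2 ⊛ 0≤b ⊕ 0≤+ m) (identity b v))
      where
      identity : ∀ B V → (+ 2 * B + V) - (0ℤ + 0ℤ) ≡ + 2 * B + V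
      identity = solve-∀
    last-level-bound₀ v@(-[1+ m ]) b 0≤b = inj₂ (≤-by-slack _ (0≤+ 2 ⊛ 0≤b) (identity b v))
      where
      identity : ∀ B V → (+ 2 * B - V) - (0ℤ + - V) ≡ + 2 * B
      identity = solve-∀

    last-level-bound : ∀ p v b → 0ℤ ≤ b → (0ℤ < p → Q * p ≤ (v + b) + + 2) →
                       + 3 * p ⁺ + v ⁻ ≤ + 2 * b + v ⊎ + 3 * p ⁺ + v ⁻ ≤ + 2 * b - v
    last-level-bound p@(+ suc n) v@(+ m) b 0≤b link =
      inj₁ (≤-by-slack _ (slack (link (+<+ (s≤s z≤n))) ⊕ 0≤b ⊕ 0≤Q-5 ⊛ 0≤+ (suc n)
                           ⊕ 0≤+ 2 ⊛ slack {+ 1} {p} (+≤+ (s≤s z≤n)))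
                         (identity Q p v b))
      where
      identity : ∀ Q P V B → (+ 2 * B + V) - (+ 3 * P + 0ℤ)
                             ≡ ((V + B) + + 2 - Q * P) + B + (Q - + 5) * P + + 2 * (P - + 1)
      identity = solve-∀
    last-level-bound p@(+ suc n) v@(-[1+ m ]) b 0≤b link =
      inj₂ (≤-by-slack _ (0≤+ 2 ⊛ slack (link (+<+ (s≤s z≤n))) ⊕ 0≤+ 2 ⊛ 0≤Q-5 ⊛ 0≤+ (suc n)
                           ⊕ 0≤+ 7 ⊛ slack {+ 1} {p} (+≤+ (s≤s z≤n)) ⊕ 0≤+ 2 ⊛ 0≤+ m ⊕ 0≤+ 5)
                         (identity Q p v b))
      where
      identity : ∀ Q P V B → (+ 2 * B - V) - (+ 3 * P + - V)
                             ≡ + 2 * ((V + B) + + 2 - Q * P) + + 2 * (Q - + 5) * P + + 7 * (P - + 1)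
                               + + 2 * (- V - + 1) + + 5
      identity = solve-∀
    last-level-bound (+ zero)   v b 0≤b _ = last-level-bound₀ v b 0≤b
    last-level-bound -[1+ n ]   v b 0≤b _ = last-level-bound₀ v b 0≤b

    -- p is the value of v one level above v 0 (p = 0 above the root). Which disjunct holds is decided by
    -- the sign of the last term v m.
    profile-bound : ∀ m p (v b : ℕ → ℤ) → (∀ i → 0ℤ ≤ b i) →
                    (0ℤ < p → Q * p ≤ (v 0 + b 0) + + 2) →
                    (∀ i → i ℕ.< m → v (suc i) + + 2 ≤ Q * (v i + b i)) →
                    (∀ i → i ℕ.< m → Q * v i ≤ (v (suc i) + b (suc i)) + + 2) →
                      + 2 * + m + + 3 * p ⁺ + v 0 ⁻ ≤ + 2 * ∑ℤ (suc m) b + ∑ℤ (suc m) v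
                    ⊎ + 2 * + m + + 3 * p ⁺ + v 0 ⁻ ≤ + 2 * ∑ℤ (suc m) b - ∑ℤ (suc m) v
    profile-bound zero p v b 0≤b link _ _ with last-level-bound p (v 0) (b 0) (0≤b 0) link
    ... | inj₁ h = inj₁ (≤-by-slack _ (slack h) (identity₁ (p ⁺) (v 0) (v 0 ⁻) (b 0)))
      where
      identity₁ : ∀ P V V⁻ B → (+ 2 * (B + 0ℤ) + (V + 0ℤ)) - (+ 2 * + 0 + + 3 * P + V⁻)
                               ≡ (+ 2 * B + V) - (+ 3 * P + V⁻)
      identity₁ = solve-∀
    ... | inj₂ h = inj₂ (≤-by-slack _ (slack h) (identity₂ (p ⁺) (v 0) (v 0 ⁻) (b 0)))
      where
      identity₂ : ∀ P V V⁻ B → (+ 2 * (B + 0ℤ) - (V + 0ℤ)) - (+ 2 * + 0 + + 3 * P + V⁻)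
                               ≡ (+ 2 * B - V) - (+ 3 * P + V⁻)
      identity₂ = solve-∀
    profile-bound (suc m) p v b 0≤b link up down
      with profile-bound m (v 0) (λ i → v (suc i)) (λ i → b (suc i)) (λ i → 0≤b (suc i))
                         (λ _ → down 0 (s≤s z≤n)) (λ i i<m → up (suc i) (s≤s i<m)) (λ i i<m → down (suc i) (s≤s i<m))
           | level-bound p (v 0 + b 0) (v 1) link (up 0 (s≤s z≤n))
    ... | inj₁ h | first = inj₁ (≤-by-slack _ (slack h ⊕ slack first ⊕ slack (i+i⁻≤3i⁺ (v 0)))
                                      (identity₁ (+ m) (p ⁺) (v 0) (v 0 ⁺) (v 0 ⁻) (v 1 ⁻) (b 0) _ _))
      where
      identity₁ : ∀ M P V V⁺ V⁻ W⁻ B ΣB ΣV →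
                  (+ 2 * (B + ΣB) + (V + ΣV)) - (+ 2 * (+ 1 + M) + + 3 * P + V⁻)
                  ≡ ((+ 2 * ΣB + ΣV) - (+ 2 * M + + 3 * V⁺ + W⁻)) + ((+ 2 * (V + B) - + 2) - (+ 3 * P - W⁻))
                    + (+ 3 * V⁺ - (V + V⁻))
      identity₁ = solve-∀
    ... | inj₂ h | first = inj₂ (≤-by-slack _ (slack h ⊕ slack first ⊕ slack (3i+i⁻≤3i⁺ (v 0)))
                                      (identity₂ (+ m) (p ⁺) (v 0) (v 0 ⁺) (v 0 ⁻) (v 1 ⁻) (b 0) _ _))
      where
      identity₂ : ∀ M P V V⁺ V⁻ W⁻ B ΣB ΣV →
                  (+ 2 * (B + ΣB) - (V + ΣV)) - (+ 2 * (+ 1 + M) + + 3 * P + V⁻)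
                  ≡ ((+ 2 * ΣB - ΣV) - (+ 2 * M + + 3 * V⁺ + W⁻)) + ((+ 2 * (V + B) - + 2) - (+ 3 * P - W⁻))
                    + (+ 3 * V⁺ - (+ 3 * V + V⁻))
      identity₂ = solve-∀

    profile-bound₀ : ∀ d (v b : ℕ → ℤ) → (∀ i → 0ℤ ≤ b i) →
                   (∀ i → i ℕ.< d → v (suc i) + + 2 ≤ Q * (v i + b i)) →
                   (∀ i → i ℕ.< d → Q * v i ≤ (v (suc i) + b (suc i)) + + 2) →
                   ∑ℤ (suc d) v ≡ 0ℤ → + d ≤ ∑ℤ (suc d) b
    profile-bound₀ d v b 0≤b up down ∑v≡0 =
      ℤ.*-cancelˡ-≤-pos (+ d) _ (+ 2) (ℤ.≤-trans 2d≤lhs (lhs≤ (profile-bound d 0ℤ v b 0≤b (λ { (+<+ ()) }) up down)))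
      where
      lhs = + 2 * + d + + 3 * 0ℤ + v 0 ⁻
      2∑b = + 2 * ∑ℤ (suc d) b
      2d≤lhs : + 2 * + d ≤ lhs
      2d≤lhs = ≤-by-slack _ (0≤⁻ (v 0)) (identity (+ 2 * + d) (v 0 ⁻))
        where
        identity : ∀ D V⁻ → D + + 3 * 0ℤ + V⁻ - D ≡ V⁻
        identity = solve-∀
      lhs≤ : lhs ≤ 2∑b + ∑ℤ (suc d) v ⊎ lhs ≤ 2∑b - ∑ℤ (suc d) v → lhs ≤ 2∑b
      lhs≤ (inj₁ h) = ℤ.≤-trans h (ℤ.≤-reflexive (trans (cong (λ s → 2∑b + s) ∑v≡0) (ℤ.+-identityʳ 2∑b)))
      lhs≤ (inj₂ h) = ℤ.≤-trans h (ℤ.≤-reflexive (trans (cong (λ s → 2∑b - s) ∑v≡0) (ℤ.+-identityʳ 2∑b)))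

    level-profile-bound : ∀ d (a b c : ℕ → ℕ) → (∀ i → c (suc i) ≡ q ℕ.* c i ℕ.+ 2) →
                          (∀ i → i ℕ.< d → a (suc i) ℕ.≤ q ℕ.* (a i ℕ.+ b i)) →
                          (∀ i → i ℕ.< d → q ℕ.* a i ℕ.≤ a (suc i) ℕ.+ b (suc i)) →
                          ∑ (suc d) a ≡ ∑ (suc d) c → d ℕ.≤ ∑ (suc d) b
    level-profile-bound d a b c c-suc up down ∑a≡∑c =
      ℤ.drop‿+≤+ (subst (+ d ≤_) (∑ℤ-+ (suc d) b)
        (profile-bound₀ d v (λ i → + b i) (λ i → 0≤+ (b i)) up′ down′ ∑v≡0))
      where
      v : ℕ → ℤ
      v i = + a i - + c i
      c-sucℤ : ∀ i → + c (suc i) ≡ Q * + c i + + 2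
      c-sucℤ i = trans (cong +_ (c-suc i)) (trans (ℤ.pos-+ (q ℕ.* c i) 2) (cong (_+ + 2) (ℤ.pos-* q (c i))))
      up′ : ∀ i → i ℕ.< d → v (suc i) + + 2 ≤ Q * (v i + + b i)
      up′ i i<d = ≤-by-slack _ (slack upℤ)
        (trans (cong (λ x → Q * (v i + + b i) - ((+ a (suc i) - x) + + 2)) (c-sucℤ i))
               (identity Q (+ a i) (+ b i) (+ c i) (+ a (suc i))))
        where
        upℤ : + a (suc i) ≤ Q * (+ a i + + b i)
        upℤ = subst (+ a (suc i) ≤_) (trans (ℤ.pos-* q _) (cong (Q *_) (ℤ.pos-+ (a i) (b i)))) (+≤+ (up i i<d))
        identity : ∀ Q A B C A′ → Q * ((A - C) + B) - ((A′ - (Q * C + + 2)) + + 2) ≡ Q * (A + B) - A′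
        identity = solve-∀
      down′ : ∀ i → i ℕ.< d → Q * v i ≤ (v (suc i) + + b (suc i)) + + 2
      down′ i i<d = ≤-by-slack _ (slack downℤ)
        (trans (cong (λ x → ((+ a (suc i) - x) + + b (suc i)) + + 2 - Q * v i) (c-sucℤ i))
               (identity Q (+ a i) (+ c i) (+ a (suc i)) (+ b (suc i))))
        where
        downℤ : Q * + a i ≤ + a (suc i) + + b (suc i)
        downℤ = subst₂ _≤_ (ℤ.pos-* q (a i)) (ℤ.pos-+ (a (suc i)) (b (suc i))) (+≤+ (down i i<d))
        identity : ∀ Q A C A′ B′ → ((A′ - (Q * C + + 2)) + B′) + + 2 - Q * (A - C) ≡ (A′ + B′) - Q * A
        identity = solve-∀
      ∑v≡0 : ∑ℤ (suc d) v ≡ 0ℤ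
      ∑v≡0 = begin
        ∑ℤ (suc d) v                       ≡⟨ ∑ℤ-+-+ (suc d) a c ⟩
        + ∑ (suc d) a - + ∑ (suc d) c      ≡⟨ cong (λ s → + s - + ∑ (suc d) c) ∑a≡∑c ⟩
        + ∑ (suc d) c - + ∑ (suc d) c      ≡⟨ ℤ.+-inverseʳ (+ ∑ (suc d) c) ⟩
        0ℤ                                 ∎
        where open ≡-Reasoning

module CompleteTreeLevels where

  open Sums
  open import Data.Nat using (ℕ; zero; suc; _+_; _*_; _^_; _≤_; _<_; _≤′_; ≤′-refl; ≤′-step; z≤n; s≤s)
  open import Data.Nat.Properties
  open import Data.Nat.Tactic.RingSolver using (solve-∀)
  open import Data.Fin using (Fin; toℕ; fromℕ<)
  open import Data.Fin.Properties using (toℕ-fromℕ<)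
  open import Data.Fin.Subset using (Subset; _∈_; _∉_; ∣_∣; inside; outside)
  open import Data.Fin.Subset.Properties using (_∈?_)
  open import Data.Vec using ([]; _∷_; here; there)
  open import Data.Product using (_,_; _×_; proj₁; proj₂)
  open import Data.Sum using (_⊎_; inj₁; inj₂)
  open import Relation.Nullary using (yes; no; contradiction)
  open import Relation.Binary.PropositionalEquality

  χ : ∀ {n} → Subset n → ℕ → ℕ
  χ []            k       = 0
  χ (_       ∷ X) (suc k) = χ X k
  χ (inside  ∷ X) zero    = 1
  χ (outside ∷ X) zero    = 0

  χ≤1 : ∀ {n} (X : Subset n) k → χ X k ≤ 1
  χ≤1 []            k       = z≤n
  χ≤1 (_       ∷ X) (suc k) = χ≤1 X k
  χ≤1 (inside  ∷ X) zero    = s≤s z≤n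
  χ≤1 (outside ∷ X) zero    = z≤n

  χ-∈ : ∀ {n} {X : Subset n} {x} → x ∈ X → χ X (toℕ x) ≡ 1
  χ-∈ here        = refl
  χ-∈ (there x∈X) = χ-∈ x∈X

  χ-∉ : ∀ {n} {X : Subset n} {x} → x ∉ X → χ X (toℕ x) ≡ 0
  χ-∉ {X = inside  ∷ X} {Fin.zero}  x∉X = contradiction here x∉X
  χ-∉ {X = outside ∷ X} {Fin.zero}  x∉X = refl
  χ-∉ {X = _       ∷ X} {Fin.suc x} x∉X = χ-∉ (λ x∈X → x∉X (there x∈X))

  ∣∣≡∑χ : ∀ {n} (X : Subset n) → ∣ X ∣ ≡ ∑ n (χ X)
  ∣∣≡∑χ []            = refl
  ∣∣≡∑χ (inside  ∷ X) = cong suc (∣∣≡∑χ X)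
  ∣∣≡∑χ (outside ∷ X) = ∣∣≡∑χ X

  module _ {n} {G : Graph n} {S B : Subset n} (δS≡B : IsVertexBoundary G S B) where

    neighbour-∈-∪-boundary : ∀ {u v} → Adj G u v → v ∈ S → u ∈ S ⊎ u ∈ B
    neighbour-∈-∪-boundary {u} {v} uv v∈S with u ∈? S
    ... | yes u∈S = inj₁ u∈S
    ... | no  u∉S = inj₂ (proj₂ (δS≡B u) (u∉S , v , v∈S , uv))

    χ-neighbour : ∀ {u v} → Adj G u v → χ S (toℕ v) ≤ χ S (toℕ u) + χ B (toℕ u)
    χ-neighbour {u} {v} uv with v ∈? S
    ... | no v∉S = subst (_≤ _) (sym (χ-∉ v∉S)) z≤n
    ... | yes v∈S with neighbour-∈-∪-boundary uv v∈S
    ...   | inj₁ u∈S = ≤-trans (χ≤1 S (toℕ v)) (≤-trans (≤-reflexive (sym (χ-∈ u∈S))) (m≤m+n _ _))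
    ...   | inj₂ u∈B = ≤-trans (χ≤1 S (toℕ v)) (≤-trans (≤-reflexive (sym (χ-∈ u∈B))) (m≤n+m _ _))

  -- In the heap numbering of completeTree, level i consists of the vertices levelStart q i + j, j < q ^ i.
  levelStart : ℕ → ℕ → ℕ
  levelStart q zero    = 0
  levelStart q (suc i) = levelStart q i + q ^ i

  levelStart-mono-≤ : ∀ q {i j} → i ≤ j → levelStart q i ≤ levelStart q j
  levelStart-mono-≤ q i≤j = mono (≤⇒≤′ i≤j)
    where
    mono : ∀ {i j} → i ≤′ j → levelStart q i ≤ levelStart q j
    mono ≤′-refl        = ≤-refl
    mono (≤′-step i≤′j) = ≤-trans (mono i≤′j) (m≤m+n _ _)

  q*levelStart+1≡levelStart-suc : ∀ q i → q * levelStart q i + 1 ≡ levelStart q (suc i)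
  q*levelStart+1≡levelStart-suc q zero    = cong (_+ 1) (*-zeroʳ q)
  q*levelStart+1≡levelStart-suc q (suc i) =
    trans (regroup q (levelStart q i) (q ^ i)) (cong (_+ q ^ suc i) (q*levelStart+1≡levelStart-suc q i))
    where
    regroup : ∀ q l m → q * (l + m) + 1 ≡ (q * l + 1) + q * m
    regroup = solve-∀

  treeSize≡levelStart : ∀ q d → treeSize q d ≡ levelStart q (suc d)
  treeSize≡levelStart q zero    = refl
  treeSize≡levelStart q (suc d) = begin
    suc (q * treeSize q d)           ≡⟨ cong (λ m → suc (q * m)) (treeSize≡levelStart q d) ⟩
    suc (q * levelStart q (suc d))   ≡⟨ +-comm 1 _ ⟩
    q * levelStart q (suc d) + 1     ≡⟨ q*levelStart+1≡levelStart-suc q (suc d) ⟩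
    levelStart q (suc (suc d))       ∎
    where open ≡-Reasoning

  ∑-levels : ∀ q d (f : ℕ → ℕ) →
             ∑ (levelStart q (suc d)) f ≡ ∑[ i < suc d ] ∑[ j < q ^ i ] f (levelStart q i + j)
  ∑-levels q zero    f = sym (+-identityʳ _)
  ∑-levels q (suc d) f = begin
    ∑ (levelStart q (suc d) + q ^ suc d) f                         ≡⟨ ∑-+ (levelStart q (suc d)) _ f ⟩
    ∑ (levelStart q (suc d)) f + level (suc d)                     ≡⟨ cong (_+ level (suc d)) (∑-levels q d f) ⟩
    ∑ (suc d) level + level (suc d)                                ≡⟨ sym (∑-suc (suc d) level) ⟩
    ∑ (suc (suc d)) level                                          ∎
    where
    open ≡-Reasoning
    level : ℕ → ℕ
    level i = ∑[ j < q ^ i ] f (levelStart q i + j)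

  levelCount : ∀ {n} → ℕ → Subset n → ℕ → ℕ
  levelCount q X i = ∑[ j < q ^ i ] χ X (levelStart q i + j)

  ∣∣≡∑levelCount : ∀ q d (X : Subset (treeSize q d)) → ∣ X ∣ ≡ ∑[ i < suc d ] levelCount q X i
  ∣∣≡∑levelCount q d X = begin
    ∣ X ∣                                   ≡⟨ ∣∣≡∑χ X ⟩
    ∑ (treeSize q d) (χ X)                  ≡⟨ cong (λ n → ∑ n (χ X)) (treeSize≡levelStart q d) ⟩
    ∑ (levelStart q (suc d)) (χ X)          ≡⟨ ∑-levels q d (χ X) ⟩
    ∑[ i < suc d ] levelCount q X i         ∎
    where open ≡-Reasoning

  levelStart+<treeSize : ∀ q {d i j} → i ≤ d → j < q ^ i → levelStart q i + j < treeSize q d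
  levelStart+<treeSize q {d} {i} {j} i≤d j<qⁱ = begin-strict
    levelStart q i + j          <⟨ +-monoʳ-< (levelStart q i) j<qⁱ ⟩
    levelStart q (suc i)        ≤⟨ levelStart-mono-≤ q (s≤s i≤d) ⟩
    levelStart q (suc d)        ≡⟨ treeSize≡levelStart q d ⟨
    treeSize q d                ∎
    where open ≤-Reasoning

  *-+-< : ∀ q {n j a} → j < n → a < q → q * j + a < q * n
  *-+-< q {n} {j} {a} j<n a<q = begin-strict
    q * j + a    <⟨ +-monoʳ-< (q * j) a<q ⟩
    q * j + q    ≡⟨ +-comm (q * j) q ⟩
    q + q * j    ≡⟨ *-suc q j ⟨
    q * suc j    ≤⟨ *-monoʳ-≤ q j<n ⟩
    q * n        ∎
    where open ≤-Reasoning

  child-index : ∀ q i j a → q * (levelStart q i + j) + suc a ≡ levelStart q (suc i) + (q * j + a)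
  child-index q i j a = begin
    q * (levelStart q i + j) + suc a            ≡⟨ regroup q (levelStart q i) j a ⟩
    (q * levelStart q i + 1) + (q * j + a)      ≡⟨ cong (_+ (q * j + a)) (q*levelStart+1≡levelStart-suc q i) ⟩
    levelStart q (suc i) + (q * j + a)          ∎
    where
    open ≡-Reasoning
    regroup : ∀ q l j a → q * (l + j) + suc a ≡ (q * l + 1) + (q * j + a)
    regroup = solve-∀

  module _ {q d} {S B : Subset (treeSize q d)} (δS≡B : IsVertexBoundary (completeTree q d) S B) where

    private
      n = treeSize q d

    χ-parent-child : ∀ {p c a} → p < n → c < n → a < q → c ≡ q * p + suc a →
                     χ S c ≤ χ S p + χ B p × χ S p ≤ χ S c + χ B c
    χ-parent-child {p} {c} p<n c<n a<q c≡ =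
        subst₂ (λ x y → χ S y ≤ χ S x + χ B x) p≡ c≡′ (χ-neighbour δS≡B (inj₁ child))
      , subst₂ (λ x y → χ S x ≤ χ S y + χ B y) p≡ c≡′ (χ-neighbour δS≡B (inj₂ child))
      where
      p≡ = toℕ-fromℕ< p<n
      c≡′ = toℕ-fromℕ< c<n
      child : ChildOf q (fromℕ< p<n) (fromℕ< c<n)
      child = fromℕ< a<q , trans c≡′ (trans c≡ (cong₂ (λ x y → q * x + suc y) (sym p≡) (sym (toℕ-fromℕ< a<q))))

    χ-level-edge : ∀ {i j a} → i < d → j < q ^ i → a < q →
                   let p = levelStart q i + j ; c = levelStart q (suc i) + (q * j + a) in
                   χ S c ≤ χ S p + χ B p × χ S p ≤ χ S c + χ B c
    χ-level-edge {i} {j} {a} i<d j<qⁱ a<q =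
      χ-parent-child (levelStart+<treeSize q (<⇒≤ i<d) j<qⁱ) (levelStart+<treeSize q i<d (*-+-< q j<qⁱ a<q))
                     a<q (sym (child-index q i j a))

    levelCount-suc-≤ : ∀ i → i < d → levelCount q S (suc i) ≤ q * (levelCount q S i + levelCount q B i)
    levelCount-suc-≤ i i<d = begin
      ∑[ k < q * q ^ i ] χ S (levelStart q (suc i) + k)                 ≡⟨ ∑-blocks q (q ^ i) _ ⟩
      ∑[ j < q ^ i ] ∑[ a < q ] χ S (levelStart q (suc i) + (q * j + a)) ≤⟨ ∑-mono-≤ (q ^ i) (λ j j<qⁱ →
                                                                            ∑-mono-≤ q (λ a a<q →
                                                                            proj₁ (χ-level-edge i<d j<qⁱ a<q))) ⟩
      ∑[ j < q ^ i ] ∑[ a < q ] parents j                               ≡⟨ ∑-cong (q ^ i) (λ j → ∑-const q (parents j)) ⟩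
      ∑[ j < q ^ i ] (q * parents j)                                    ≡⟨ ∑-distribˡ-* (q ^ i) q parents ⟩
      q * ∑ (q ^ i) parents                                             ≡⟨ cong (q *_) (∑-distrib-+ (q ^ i) _ _) ⟩
      q * (levelCount q S i + levelCount q B i)                         ∎
      where
      open ≤-Reasoning
      parents : ℕ → ℕ
      parents j = χ S (levelStart q i + j) + χ B (levelStart q i + j)

    *-levelCount-≤ : ∀ i → i < d → q * levelCount q S i ≤ levelCount q S (suc i) + levelCount q B (suc i)
    *-levelCount-≤ i i<d = begin
      q * levelCount q S i                                   ≡⟨ ∑-distribˡ-* (q ^ i) q _ ⟨
      ∑[ j < q ^ i ] (q * χ S (levelStart q i + j))          ≡⟨ ∑-cong (q ^ i) (λ j → ∑-const q _) ⟨
      ∑[ j < q ^ i ] ∑[ a < q ] χ S (levelStart q i + j)     ≤⟨ ∑-mono-≤ (q ^ i) (λ j j<qⁱ →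
                                                                ∑-mono-≤ q (λ a a<q →
                                                                proj₂ (χ-level-edge i<d j<qⁱ a<q))) ⟩
      ∑[ j < q ^ i ] ∑[ a < q ] children (q * j + a)          ≡⟨ ∑-blocks q (q ^ i) children ⟨
      ∑ (q * q ^ i) children                                  ≡⟨ ∑-distrib-+ (q ^ suc i) _ _ ⟩
      levelCount q S (suc i) + levelCount q B (suc i)         ∎
      where
      open ≤-Reasoning
      children : ℕ → ℕ
      children k = χ S (levelStart q (suc i) + k) + χ B (levelStart q (suc i) + k)

  2*levelStart-suc : ∀ q i → 2 * levelStart q (suc i) ≡ q * (2 * levelStart q i) + 2
  2*levelStart-suc q i = trans (cong (2 *_) (sym (q*levelStart+1≡levelStart-suc q i))) (identity q (levelStart q i))
    where
    identity : ∀ q l → 2 * (q * l + 1) ≡ q * (2 * l) + 2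
    identity = solve-∀

  ∑2*levelStart≤levelStart : ∀ {q} → 3 ≤ q → ∀ d → ∑[ i < suc d ] (2 * levelStart q i) ≤ levelStart q (suc d)
  ∑2*levelStart≤levelStart         3≤q zero    = z≤n
  ∑2*levelStart≤levelStart {q} 3≤q (suc d) = begin
    ∑[ i < suc (suc d) ] (2 * levelStart q i)    ≡⟨ ∑-suc (suc d) (λ i → 2 * levelStart q i) ⟩
    ∑[ i < suc d ] (2 * levelStart q i) + 2 * L  ≤⟨ +-monoˡ-≤ (2 * L) (∑2*levelStart≤levelStart 3≤q d) ⟩
    3 * L                                        ≤⟨ *-monoˡ-≤ L 3≤q ⟩
    q * L                                        ≤⟨ m≤m+n (q * L) 1 ⟩
    q * L + 1                                    ≡⟨ q*levelStart+1≡levelStart-suc q (suc d) ⟩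
    levelStart q (suc (suc d))                   ∎
    where
    open ≤-Reasoning
    L = levelStart q (suc d)

open import Data.Nat using (ℕ; suc; _*_; _≤_; s≤s; z≤n)
open import Data.Nat.Properties using (≤-trans; ≤-reflexive)
open import Data.Product using (_,_)
open import Relation.Binary.PropositionalEquality using (sym; trans; subst)
open Sums using (∑)
open LevelProfile using (level-profile-bound)
open CompleteTreeLevels

theorem3p1 : (q d : ℕ) → 5 ≤ q → PhiVAtLeast (completeTree q d) d
theorem3p1 q d 5≤q = ∑ (suc d) c , s≤treeSize , λ S B ∣S∣≡s δS≡B →
  subst (d ≤_) (sym (∣∣≡∑levelCount q d B))
    (level-profile-bound 5≤q d (levelCount q S) (levelCount q B) c (2*levelStart-suc q)
       (levelCount-suc-≤ δS≡B) (*-levelCount-≤ δS≡B) (trans (sym (∣∣≡∑levelCount q d S)) ∣S∣≡s))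
  where
  c : ℕ → ℕ
  c i = 2 * levelStart q i
  s≤treeSize : ∑ (suc d) c ≤ treeSize q d
  s≤treeSize = ≤-trans (∑2*levelStart≤levelStart (≤-trans (s≤s (s≤s (s≤s z≤n))) 5≤q) d)
                       (≤-reflexive (sym (treeSize≡levelStart q d)))
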